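{- Let $n,m$ be positive integers and $\mathbf a,\mathbf b\in\mathbb N^n$ with $\mathbf a\trianglerighteq\mathbf b$. There is a bijection between the plane partitions of skew shape $\theta(\mathbf a,\mathbf b)$ with entries at most $m$ and the integral flows in $\mathcal F_{G(n,m)}(\mathbf a,\mathbf b)$ (i.e., the points of $\mathcal F_{G(n,m)}(\mathbf a,\mathbf b)$ all of whose edge values are integers).
   Context: For $\mathbf v,\mathbf w\in\mathbb N^n$, $\mathbf v\trianglerighteq\mathbf w$ means $\sum_{j\le i}v_j\ge\sum_{j\le i}w_j$ for all $i$. $\theta(\mathbf a,\mathbf b)=\lambda/\mu$ with $\lambda=(a_1+\dots+a_n,\dots,a_1+a_2,a_1)$ and $\mu=(b_1+\dots+b_n,\dots,b_1+b_2,b_1)$ (so $\mu\subseteq\lambda$ when $\mathbf a\trianglerighteq\mathbf b$). A plane partition of skew shape $\lambda/\mu$ is a filling of the cells $(i,j)$, $\mu_i<j\le\lambda_i$ (English convention) by nonnegative integers weakly decreasing along each row (left to right) and each column (top to bottom). $G(n,m)$ is the directed graph with vertex set $\{(i,j):1\le i\le n,\ 0\le j\le m\}\cup\{s\}$ and edges: $((i,j),(i,j+1))$ for $1\le i\le n$, $0\le j\le m-1$; $((i,j),(i+1,j))$ for $1\le i\le n-1$, $0\le j\le m$; and $((n,j),s)$ for $0\le j\le m$. $\mathcal F_{G(n,m)}(\mathbf a,\mathbf b)$ is the set of $f:E(G(n,m))\to\mathbb R_{\ge0}$ such that at each vertex, outflow minus inflow equals: $a_i$ at $(i,0)$, $-b_i$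 at $(i,m)$, $-\sum a_i+\sum b_i$ at $s$, $0$ elsewhere. -}

module Defs where

open import Data.Nat using (ℕ; zero; suc; _+_; _∸_; _≤_; _<_; _≡ᵇ_)
open import Data.Fin using (Fin; toℕ) renaming (zero to fzero; suc to fsuc)
open import Data.Integer using (ℤ; +_; _-_)
open import Data.Product using (Σ; _×_; _,_; proj₁)
open import Data.Sum using (_⊎_; inj₁; inj₂)
open import Data.Unit using (⊤; tt)
open import Data.Empty using (⊥)
open import Data.Bool using (if_then_else_)
open import Relation.Nullary using (¬_)
open import Relation.Binary.PropositionalEquality using (_≡_; refl; sym; trans)
open import Relation.Binary.Bundles using (Setoid)
open import Level using (0ℓ)

∑ : ∀ {k} → (Fin k → ℕ) → ℕ
∑ {zero}  f = 0
∑ {suc k} f = f fzero + ∑ (λ i → f (fsuc i))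

psum : ∀ {n} → (Fin n → ℕ) → ℕ → ℕ
psum {zero}  a k       = 0
psum {suc n} a zero    = 0
psum {suc n} a (suc k) = a fzero + psum (λ i → a (fsuc i)) k

_⊵_ : ∀ {n} → (Fin n → ℕ) → (Fin n → ℕ) → Set
_⊵_ {n} a b = ∀ k → k ≤ n → psum b k ≤ psum a k

-- θ(a,b) = λ/μ.  Rows are indexed by r : Fin n (r = i-1 for paper row i),
-- columns by c : ℕ, 1-based.  λ_{r} = a₁ + … + a_{n-r}.

shapeOf : ∀ {n} → (Fin n → ℕ) → Fin n → ℕ
shapeOf {n} a r = psum a (n ∸ toℕ r)

InCell : ∀ {n} → (a b : Fin n → ℕ) → Fin n → ℕ → Set
InCell a b r c = shapeOf b r < c × c ≤ shapeOf a r

Filling : ∀ {n} → (a b : Fin n → ℕ) → Set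
Filling a b = ∀ r c → InCell a b r c → ℕ

record PlanePartition (n m : ℕ) (a b : Fin n → ℕ) : Set where
  field
    π       : Filling a b
    bounded : ∀ r c (p : InCell a b r c) → π r c p ≤ m
    rowDec  : ∀ r c c' (p : InCell a b r c) (q : InCell a b r c') →
              c ≤ c' → π r c' q ≤ π r c p
    colDec  : ∀ r r' c (p : InCell a b r c) (q : InCell a b r' c) →
              toℕ r ≤ toℕ r' → π r' c q ≤ π r c p

PPSetoid : (n m : ℕ) (a b : Fin n → ℕ) → Setoid 0ℓ 0ℓ
PPSetoid n m a b = record
  { Carrier = PlanePartition n m a b
  ; _≈_ = λ P Q → ∀ r c p → PlanePartition.π P r c p ≡ PlanePartition.π Q r c p
  ; isEquivalence = record
      { refl = λ r c p → refl
      ; sym = λ e r c p → sym (e r c p)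
      ; trans = λ e f r c p → trans (e r c p) (f r c p) } }

-- The graph G(n,m).  Vertex (i,j) of the paper (1 ≤ i ≤ n, 0 ≤ j ≤ m)
-- is  inj₁ (i-1 , j) ;  the sink s is  inj₂ tt.

Vertex : ℕ → ℕ → Set
Vertex n m = (Fin n × Fin (suc m)) ⊎ ⊤

Edge : ∀ n m → Vertex n m → Vertex n m → Set
Edge n m (inj₁ (i , j)) (inj₁ (i' , j')) =
  (i ≡ i' × toℕ j' ≡ suc (toℕ j)) ⊎ (toℕ i' ≡ suc (toℕ i) × j ≡ j')
Edge n m (inj₁ (i , j)) (inj₂ _) = suc (toℕ i) ≡ n
Edge n m (inj₂ _) _ = ⊥

∑V : ∀ {n m} → (Vertex n m → ℕ) → ℕ
∑V g = ∑ (λ i → ∑ (λ j → g (inj₁ (i , j)))) + g (inj₂ tt)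

demand : ∀ {n} m → (a b : Fin n → ℕ) → Vertex n m → ℤ
demand m a b (inj₁ (i , j)) =
  (+ (if toℕ j ≡ᵇ 0 then a i else 0)) - (+ (if toℕ j ≡ᵇ m then b i else 0))
demand m a b (inj₂ _) = (+ ∑ b) - (+ ∑ a)

record IntegralFlow (n m : ℕ) (a b : Fin n → ℕ) : Set where
  field
    f        : Vertex n m → Vertex n m → ℕ
    support  : ∀ u v → ¬ Edge n m u v → f u v ≡ 0
    conserve : ∀ v → (+ ∑V (λ w → f v w)) - (+ ∑V (λ w → f w v)) ≡ demand m a b v

FlowSetoid : (n m : ℕ) (a b : Fin n → ℕ) → Setoid 0ℓ 0ℓ
FlowSetoid n m a b = record
  { Carrier = IntegralFlow n m a b
  ; _≈_ = λ F G → ∀ u v → IntegralFlow.f F u v ≡ IntegralFlow.f G u v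
  ; isEquivalence = record
      { refl = λ u v → refl
      ; sym = λ e u v → sym (e u v)
      ; trans = λ e e' u v → trans (e u v) (e' u v) } }

-- A flow on G(n,m) is recorded by its cut table p k t: what the first k rows of the
-- grid carry across the cut between columns t ∸ 1 and t (a cut at t = 0 meets the
-- supplies a, one at t = m + 1 the demands b). Conservation makes p k t decrease in t,
-- from a₁ + ⋯ + a_k to b₁ + ⋯ + b_k, and increase in k; conversely the increments of
-- any such table, in k along horizontal edges and in t along vertical ones, form a flow.
-- Row k of a cut table is also row k of θ(a,b) counted from the bottom, whose cells are
-- the c with b₁ + ⋯ + b_k < c ≤ a₁ + ⋯ + a_k, under the correspondence
--   c ≤ p k t  ⇔  t ≤ π c,
-- i.e. π c = #{t ∈ [1, m] | c ≤ p k t} and p k t = b₁ + ⋯ + b_k + #{c | t ≤ π c}.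
-- Counting makes rows of π weakly decreasing automatically, and its columns are weakly
-- decreasing exactly when p is increasing in k.
module Submission where

open import Defs
open import Data.Nat using (ℕ; zero; suc; _+_; _∸_; _≤_; _<_; _≡ᵇ_; z≤n; s≤s; _≤?_)
open import Data.Nat.Properties
open import Data.Fin using (Fin; toℕ; fromℕ<) renaming (zero to fzero; suc to fsuc)
open import Data.Fin.Properties using (toℕ-fromℕ<; toℕ-injective; toℕ<n)
open import Data.Integer as ℤ using (ℤ)
import Data.Integer.Properties as ℤ
open import Data.Integer.Tactic.RingSolver using (solve-∀)
open import Data.Bool using (Bool; true; false; if_then_else_; _∧_)
open import Data.Bool.Properties using (T-≡; ∧-zeroʳ)
open import Data.Product using (Σ; _×_; _,_; proj₁; proj₂)
open import Data.Sum using (_⊎_; inj₁; inj₂; [_,_]′)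
open import Data.Unit using (tt)
open import Data.Empty using (⊥-elim)
open import Function using (flip)
open import Function.Bundles using (_⇔_; mk⇔; Equivalence; Inverse; Bijection)
open import Function.Construct.Composition using (_⇔-∘_)
open import Function.Construct.Symmetry using (⇔-sym)
open import Function.Properties.Inverse using (Inverse⇒Bijection)
open import Relation.Nullary using (¬_; yes; no; does)
open import Relation.Nullary.Decidable using (does-⇔; dec-true; dec-false)
open import Relation.Unary using (Decidable)
open import Relation.Binary.Bundles using (Setoid)
open import Relation.Binary.Definitions using (Reflexive; Transitive)
open import Relation.Binary.PropositionalEquality
open import Algebra.Properties.CommutativeSemigroup +-commutativeSemigroup
  using () renaming (interchange to +-interchange; xy∙z≈xz∙y to +-rearrange; x∙yz≈zx∙y to +-rotate)

when : Bool → ℕ → ℕ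
when b x = if b then x else 0

when-∧ : ∀ p q x → when (p ∧ q) x ≡ when p (when q x)
when-∧ true  q x = refl
when-∧ false q x = refl

when-cong : ∀ {b x y} → (b ≡ true → x ≡ y) → when b x ≡ when b y
when-cong {true}  x≡y = x≡y refl
when-cong {false} _   = refl

true≢false : true ≢ false
true≢false ()

∧-true⇒ : ∀ {p q} → p ∧ q ≡ true → p ≡ true × q ≡ true
∧-true⇒ {true} {true} _ = refl , refl

≡ᵇ-sym : ∀ x y → (x ≡ᵇ y) ≡ (y ≡ᵇ x)
≡ᵇ-sym x y = does-⇔ (mk⇔ sym sym) (x ≟ y) (y ≟ x)

≡ᵇ-true⇒≡ : ∀ {x y} → (x ≡ᵇ y) ≡ true → x ≡ y
≡ᵇ-true⇒≡ {x} {y} e = ≡ᵇ⇒≡ x y (Equivalence.from T-≡ e)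

toℕ-onto : ∀ {N} k → k < N → Σ (Fin N) (λ i → toℕ i ≡ k)
toℕ-onto k k<N = fromℕ< k<N , toℕ-fromℕ< k<N

ℤ-diff-≡⇔ : ∀ x y c d → ((ℤ.+ x) ℤ.- (ℤ.+ y) ≡ (ℤ.+ c) ℤ.- (ℤ.+ d)) ⇔ (x + d ≡ c + y)
ℤ-diff-≡⇔ x y c d = mk⇔ to from
  where
  open ≡-Reasoning
  X = ℤ.+ x ; Y = ℤ.+ y ; C = ℤ.+ c ; D = ℤ.+ d
  split : ∀ U V W → U ℤ.+ W ≡ (U ℤ.- V) ℤ.+ (V ℤ.+ W)
  split = solve-∀
  join : ∀ U V W → (U ℤ.- W) ℤ.+ (V ℤ.+ W) ≡ U ℤ.+ V
  join = solve-∀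
  shift : ∀ U V W → U ℤ.- V ≡ (U ℤ.+ W) ℤ.- (V ℤ.+ W)
  shift = solve-∀
  unshift : ∀ U V W → (U ℤ.+ V) ℤ.- (V ℤ.+ W) ≡ U ℤ.- W
  unshift = solve-∀
  to : X ℤ.- Y ≡ C ℤ.- D → x + d ≡ c + y
  to e = ℤ.+-injective (begin
    ℤ.+ (x + d)              ≡⟨ ℤ.pos-+ x d ⟩
    X ℤ.+ D                  ≡⟨ split X Y D ⟩
    (X ℤ.- Y) ℤ.+ (Y ℤ.+ D)  ≡⟨ cong (ℤ._+ (Y ℤ.+ D)) e ⟩
    (C ℤ.- D) ℤ.+ (Y ℤ.+ D)  ≡⟨ join C Y D ⟩
    C ℤ.+ Y                  ≡⟨ ℤ.pos-+ c y ⟨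
    ℤ.+ (c + y)              ∎)
  from : x + d ≡ c + y → X ℤ.- Y ≡ C ℤ.- D
  from e = begin
    X ℤ.- Y                  ≡⟨ shift X Y D ⟩
    (X ℤ.+ D) ℤ.- (Y ℤ.+ D)  ≡⟨ cong (ℤ._- (Y ℤ.+ D)) (trans (sym (ℤ.pos-+ x d)) (trans (cong ℤ.+_ e) (ℤ.pos-+ c y))) ⟩
    (C ℤ.+ Y) ℤ.- (Y ℤ.+ D)  ≡⟨ unshift C Y D ⟩
    C ℤ.- D                  ∎

-- Entry x of a Fin-indexed family, read as 0 when x is out of range.
at : ∀ {N} → (Fin N → ℕ) → ℕ → ℕ
at {zero}  g x       = 0
at {suc N} g zero    = g fzero
at {suc N} g (suc x) = at (λ i → g (fsuc i)) x

at-toℕ : ∀ {N} (g : Fin N → ℕ) i → at g (toℕ i) ≡ g i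
at-toℕ g fzero    = refl
at-toℕ g (fsuc i) = at-toℕ (λ i → g (fsuc i)) i

at-∘toℕ : ∀ {N} (G : ℕ → ℕ) {x} → x < N → at {N} (λ i → G (toℕ i)) x ≡ G x
at-∘toℕ {suc N} G {zero}  _         = refl
at-∘toℕ {suc N} G {suc x} (s≤s x<N) = at-∘toℕ (λ k → G (suc k)) x<N

at-≥ : ∀ {N} (g : Fin N → ℕ) {x} → N ≤ x → at g x ≡ 0
at-≥ {zero}  g         _         = refl
at-≥ {suc N} g {suc x} (s≤s N≤x) = at-≥ (λ i → g (fsuc i)) N≤x

at-cong : ∀ {N} {g h : Fin N → ℕ} → (∀ i → g i ≡ h i) → ∀ x → at g x ≡ at h x
at-cong {zero}  e x       = refl
at-cong {suc N} e zero    = e fzero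
at-cong {suc N} e (suc x) = at-cong (λ i → e (fsuc i)) x

at-zero : ∀ {N} {g : Fin N → ℕ} → (∀ i → g i ≡ 0) → ∀ x → at g x ≡ 0
at-zero {zero}  e x       = refl
at-zero {suc N} e zero    = e fzero
at-zero {suc N} e (suc x) = at-zero (λ i → e (fsuc i)) x

at-≤ : ∀ {N M} {g : Fin N → ℕ} → (∀ i → g i ≤ M) → ∀ x → at g x ≤ M
at-≤ {zero}  g≤M x       = z≤n
at-≤ {suc N} g≤M zero    = g≤M fzero
at-≤ {suc N} g≤M (suc x) = at-≤ (λ i → g≤M (fsuc i)) x

at² : ∀ {N M} → (Fin N → Fin M → ℕ) → ℕ → ℕ → ℕ
at² g x y = at (λ i → at (g i) y) x

at²-toℕ : ∀ {N M} (g : Fin N → Fin M → ℕ) i j → at² g (toℕ i) (toℕ j) ≡ g i j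
at²-toℕ g i j = trans (at-toℕ _ i) (at-toℕ (g i) j)

at²-cong : ∀ {N M} {g h : Fin N → Fin M → ℕ} → (∀ i j → g i j ≡ h i j) → ∀ x y → at² g x y ≡ at² h x y
at²-cong e x y = at-cong (λ i → at-cong (e i) y) x

at²-zero : ∀ {N M} {g : Fin N → Fin M → ℕ} → (∀ i j → g i j ≡ 0) → ∀ x y → at² g x y ≡ 0
at²-zero e x y = at-zero (λ i → at-zero (e i) y) x

at²-≥ˡ : ∀ {N M} (g : Fin N → Fin M → ℕ) {x} y → N ≤ x → at² g x y ≡ 0
at²-≥ˡ g y N≤x = at-≥ _ N≤x

at²-≥ʳ : ∀ {N M} (g : Fin N → Fin M → ℕ) x {y} → M ≤ y → at² g x y ≡ 0
at²-≥ʳ g x M≤y = at-zero (λ i → at-≥ (g i) M≤y) x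

∑-cong : ∀ {N} {f g : Fin N → ℕ} → (∀ i → f i ≡ g i) → ∑ f ≡ ∑ g
∑-cong {zero}  e = refl
∑-cong {suc N} e = cong₂ _+_ (e fzero) (∑-cong (λ i → e (fsuc i)))

∑-zero : ∀ {N} {f : Fin N → ℕ} → (∀ i → f i ≡ 0) → ∑ f ≡ 0
∑-zero {zero}  e = refl
∑-zero {suc N} e = cong₂ _+_ (e fzero) (∑-zero (λ i → e (fsuc i)))

∑-distrib-+ : ∀ {N} (f g : Fin N → ℕ) → ∑ (λ i → f i + g i) ≡ ∑ f + ∑ g
∑-distrib-+ {zero}  f g = refl
∑-distrib-+ {suc N} f g =
  trans (cong (f fzero + g fzero +_) (∑-distrib-+ (λ i → f (fsuc i)) (λ i → g (fsuc i)))) (+-interchange (f fzero) (g fzero) _ _)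

∑²-distrib-+ : ∀ {N M} (g h : Fin N → Fin M → ℕ) →
               ∑ (λ i → ∑ (λ j → g i j + h i j)) ≡ ∑ (λ i → ∑ (g i)) + ∑ (λ i → ∑ (h i))
∑²-distrib-+ g h = trans (∑-cong (λ i → ∑-distrib-+ (g i) (h i))) (∑-distrib-+ (λ i → ∑ (g i)) (λ i → ∑ (h i)))

∑-when : ∀ {N} b (g : Fin N → ℕ) → ∑ (λ i → when b (g i)) ≡ when b (∑ g)
∑-when true  g = refl
∑-when {N} false g = ∑-zero {N} (λ _ → refl)

∑-δ : ∀ {N} (g : Fin N → ℕ) x → ∑ (λ i → when (toℕ i ≡ᵇ x) (g i)) ≡ at g x
∑-δ {zero}  g x       = refl
∑-δ {suc N} g zero    = trans (cong (g fzero +_) (∑-zero {N} (λ _ → refl))) (+-identityʳ _)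
∑-δ {suc N} g (suc x) = ∑-δ (λ i → g (fsuc i)) x

∑²-δ : ∀ {N M} (g : Fin N → Fin M → ℕ) x y →
       ∑ (λ i → ∑ (λ j → when ((toℕ i ≡ᵇ x) ∧ (toℕ j ≡ᵇ y)) (g i j))) ≡ at² g x y
∑²-δ g x y = begin
  ∑ (λ i → ∑ (λ j → when ((toℕ i ≡ᵇ x) ∧ (toℕ j ≡ᵇ y)) (g i j)))
    ≡⟨ ∑-cong (λ i → trans (∑-cong (λ j → when-∧ (toℕ i ≡ᵇ x) (toℕ j ≡ᵇ y) (g i j)))
                            (∑-when (toℕ i ≡ᵇ x) (λ j → when (toℕ j ≡ᵇ y) (g i j)))) ⟩
  ∑ (λ i → when (toℕ i ≡ᵇ x) (∑ (λ j → when (toℕ j ≡ᵇ y) (g i j))))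
    ≡⟨ ∑-cong (λ i → cong (when (toℕ i ≡ᵇ x)) (∑-δ (g i) y)) ⟩
  ∑ (λ i → when (toℕ i ≡ᵇ x) (at (g i) y))
    ≡⟨ ∑-δ (λ i → at (g i) y) x ⟩
  at² g x y ∎
  where open ≡-Reasoning

∑²-δʳ : ∀ {N M} (g : Fin N → Fin M → ℕ) x y →
        ∑ (λ i → ∑ (λ j → when ((x ≡ᵇ toℕ i) ∧ (y ≡ᵇ toℕ j)) (g i j))) ≡ at² g x y
∑²-δʳ g x y = trans (∑-cong (λ i → ∑-cong (λ j → cong (λ b → when b (g i j))
                      (cong₂ _∧_ (≡ᵇ-sym x (toℕ i)) (≡ᵇ-sym y (toℕ j))))))
                    (∑²-δ g x y)

∑-δ-last : ∀ {N} (g : Fin N → ℕ) → ∑ (λ i → when (suc (toℕ i) ≡ᵇ N) (g i)) ≡ at g (N ∸ 1)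
∑-δ-last {zero}  g = refl
∑-δ-last {suc N} g = ∑-δ g N

≤-congʳ⇔ : ∀ {x y z} → y ≡ z → (x ≤ y) ⇔ (x ≤ z)
≤-congʳ⇔ {x} y≡z = mk⇔ (subst (x ≤_) y≡z) (subst (x ≤_) (sym y≡z))

InInterval : ℕ → ℕ → ℕ → Set
InInterval lo len c = lo < c × c ≤ lo + len

InInterval-first : ∀ lo len → InInterval lo (suc len) (suc lo)
InInterval-first lo len = n<1+n lo , ≤-trans (s≤s (m≤m+n lo len)) (≤-reflexive (sym (+-suc lo len)))

InInterval-shift : ∀ {lo len c} → InInterval (suc lo) len c → InInterval lo (suc len) c
InInterval-shift {lo} {len} (lo<c , c≤) = <-trans (n<1+n lo) lo<c , ≤-trans c≤ (≤-reflexive (sym (+-suc lo len)))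

-- The number of c ∈ (lo, lo + len] with P c.
count : {P : ℕ → Set} → Decidable P → ℕ → ℕ → ℕ
count P? lo zero      = 0
count P? lo (suc len) = (if does (P? (suc lo)) then 1 else 0) + count P? (suc lo) len

module _ {P Q : ℕ → Set} (P? : Decidable P) (Q? : Decidable Q) where

  count-cong : ∀ lo len → (∀ c → InInterval lo len c → P c ⇔ Q c) → count P? lo len ≡ count Q? lo len
  count-cong lo zero      P⇔Q = refl
  count-cong lo (suc len) P⇔Q =
    cong₂ _+_ (cong (λ b → if b then 1 else 0) (does-⇔ (P⇔Q (suc lo) (InInterval-first lo len)) (P? (suc lo)) (Q? (suc lo))))
              (count-cong (suc lo) len (λ c c∈ → P⇔Q c (InInterval-shift c∈)))

  count-mono : ∀ lo len → (∀ c → InInterval lo len c → P c → Q c) → count P? lo len ≤ count Q? lo len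
  count-mono lo zero      P⇒Q = z≤n
  count-mono lo (suc len) P⇒Q with P? (suc lo) | Q? (suc lo)
  ... | yes _ | yes _ = s≤s rest
    where rest = count-mono (suc lo) len (λ c c∈ → P⇒Q c (InInterval-shift c∈))
  ... | yes p | no ¬q = ⊥-elim (¬q (P⇒Q (suc lo) (InInterval-first lo len) p))
  ... | no _  | yes _ = m≤n⇒m≤1+n (count-mono (suc lo) len (λ c c∈ → P⇒Q c (InInterval-shift c∈)))
  ... | no _  | no _  = count-mono (suc lo) len (λ c c∈ → P⇒Q c (InInterval-shift c∈))

count-≤ : ∀ {P : ℕ → Set} (P? : Decidable P) lo len → count P? lo len ≤ len
count-≤ P? lo zero = z≤n
count-≤ P? lo (suc len) with does (P? (suc lo))
... | true  = s≤s (count-≤ P? (suc lo) len)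
... | false = m≤n⇒m≤1+n (count-≤ P? (suc lo) len)

count-yes : ∀ {P : ℕ → Set} (P? : Decidable P) lo len → P (suc lo) → count P? lo (suc len) ≡ suc (count P? (suc lo) len)
count-yes P? lo len p = cong (λ b → (if b then 1 else 0) + count P? (suc lo) len) (dec-true (P? (suc lo)) p)

count-no : ∀ {P : ℕ → Set} (P? : Decidable P) lo len → ¬ P (suc lo) → count P? lo (suc len) ≡ count P? (suc lo) len
count-no P? lo len ¬p = cong (λ b → (if b then 1 else 0) + count P? (suc lo) len) (dec-false (P? (suc lo)) ¬p)

count-none : ∀ {P : ℕ → Set} (P? : Decidable P) lo len → (∀ c → InInterval lo len c → ¬ P c) → count P? lo len ≡ 0
count-none P? lo zero      ¬P = refl
count-none P? lo (suc len) ¬P = trans (count-no P? lo len (¬P (suc lo) (InInterval-first lo len)))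
                                      (count-none P? (suc lo) len (λ c c∈ → ¬P c (InInterval-shift c∈)))

count-threshold : ∀ lo len x → lo ≤ x → x ≤ lo + len → count (_≤? x) lo len ≡ x ∸ lo
count-threshold lo zero x lo≤x x≤lo = sym (m≤n⇒m∸n≡0 (≤-trans x≤lo (≤-reflexive (+-identityʳ lo))))
count-threshold lo (suc len) x lo≤x x≤ with suc lo ≤? x
... | yes lo<x = begin
  count (_≤? x) lo (suc len)      ≡⟨ count-yes (_≤? x) lo len lo<x ⟩
  suc (count (_≤? x) (suc lo) len) ≡⟨ cong suc (count-threshold (suc lo) len x lo<x (≤-trans x≤ (≤-reflexive (+-suc lo len)))) ⟩
  suc (x ∸ suc lo)                ≡⟨ +-∸-assoc 1 lo<x ⟨
  x ∸ lo                          ∎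
  where open ≡-Reasoning
... | no lo≮x = begin
  count (_≤? x) lo (suc len) ≡⟨ count-no (_≤? x) lo len lo≮x ⟩
  count (_≤? x) (suc lo) len ≡⟨ count-none (_≤? x) (suc lo) len (λ c (lo<c , _) c≤x → lo≮x (≤-trans (<⇒≤ lo<c) c≤x)) ⟩
  0                          ≡⟨ n∸n≡0 lo ⟨
  lo ∸ lo                    ≡⟨ cong (_∸ lo) (≤-antisym (≮⇒≥ lo≮x) lo≤x) ⟨
  x ∸ lo                     ∎
  where open ≡-Reasoning

count-all : ∀ {P : ℕ → Set} (P? : Decidable P) lo len → (∀ c → InInterval lo len c → P c) → count P? lo len ≡ len
count-all P? lo len all = begin
  count P? lo len                  ≡⟨ count-cong P? (_≤? lo + len) lo len (λ c c∈ → mk⇔ (λ _ → proj₂ c∈) (λ _ → all c c∈)) ⟩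
  count (_≤? lo + len) lo len      ≡⟨ count-threshold lo len (lo + len) (m≤m+n lo len) ≤-refl ⟩
  lo + len ∸ lo                    ≡⟨ m+n∸m≡n lo len ⟩
  len                              ∎
  where open ≡-Reasoning

DownClosedOn : (ℕ → Set) → ℕ → ℕ → Set
DownClosedOn P lo len = ∀ {c c'} → lo < c → c ≤ c' → c' ≤ lo + len → P c' → P c

count-galois : ∀ {P : ℕ → Set} (P? : Decidable P) lo len → DownClosedOn P lo len →
               ∀ {c} → InInterval lo len c → P c ⇔ c ≤ lo + count P? lo len
count-galois P? lo zero _ (lo<c , c≤lo) = ⊥-elim (<⇒≱ lo<c (≤-trans c≤lo (≤-reflexive (+-identityʳ lo))))
count-galois P? lo (suc len) closed {c} (lo<c , c≤) with P? (suc lo)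
... | yes p with m≤n⇒m<n∨m≡n lo<c
...   | inj₂ refl = mk⇔ (λ _ → ≤-trans (s≤s (m≤m+n lo _)) (≤-reflexive (sym (+-suc lo _)))) (λ _ → p)
...   | inj₁ slo<c = mk⇔ (λ pc → subst (c ≤_) (sym (+-suc lo _)) (Equivalence.to IH pc))
                          (λ c≤ → Equivalence.from IH (subst (c ≤_) (+-suc lo _) c≤))
  where
  IH = count-galois P? (suc lo) len
         (λ {c₁} lo<c₁ c₁≤c' c'≤ → closed (<-trans (n<1+n lo) lo<c₁) c₁≤c' (≤-trans c'≤ (≤-reflexive (sym (+-suc lo len)))))
         (slo<c , ≤-trans c≤ (≤-reflexive (+-suc lo len)))
count-galois P? lo (suc len) closed {c} (lo<c , c≤) | no ¬p =
  mk⇔ (λ pc → ⊥-elim (¬p (closed (n<1+n lo) lo<c c≤ pc)))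
      (λ c≤lo+0 → ⊥-elim (<⇒≱ lo<c (≤-trans c≤lo+0 (≤-reflexive (trans (cong (lo +_) none) (+-identityʳ lo))))))
  where
  none : count P? (suc lo) len ≡ 0
  none = count-none P? (suc lo) len (λ c' (slo<c' , c'≤) pc' →
           ¬p (closed (n<1+n lo) (<⇒≤ slo<c') (≤-trans c'≤ (≤-reflexive (sym (+-suc lo len)))) pc'))

module _ {R : ℕ → ℕ → Set} (R-refl : Reflexive R) (R-trans : Transitive R) where

  stepwise : ∀ (g : ℕ → ℕ) h → (∀ i → i < h → R (g i) (g (suc i))) → ∀ {i j} → i ≤ j → j ≤ h → R (g i) (g j)
  stepwise g h step {j = zero}  z≤n   _    = R-refl
  stepwise g h step {i} {suc j} i≤sj sj≤h with m≤n⇒m<n∨m≡n i≤sj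
  ... | inj₂ refl      = R-refl
  ... | inj₁ (s≤s i≤j) = R-trans (stepwise g h step i≤j (<⇒≤ sj≤h)) (step j sj≤h)

∸-telescope : ∀ {x y z} → x ≤ y → y ≤ z → (z ∸ y) + (y ∸ x) ≡ z ∸ x
∸-telescope {x} {y} {z} x≤y y≤z = trans (sym (+-∸-assoc (z ∸ y) x≤y)) (cong (_∸ x) (m∸n+n≡m y≤z))

sumBelow : ℕ → (ℕ → ℕ) → ℕ
sumBelow zero    g = 0
sumBelow (suc k) g = sumBelow k g + g k

sumBelow-cong : ∀ k {g h : ℕ → ℕ} → (∀ i → i < k → g i ≡ h i) → sumBelow k g ≡ sumBelow k h
sumBelow-cong zero    e = refl
sumBelow-cong (suc k) e = cong₂ _+_ (sumBelow-cong k (λ i i<k → e i (m<n⇒m<1+n i<k))) (e k ≤-refl)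

sumBelow-telescope : ∀ k (g : ℕ → ℕ) → (∀ i → i < k → g i ≤ g (suc i)) → sumBelow k (λ i → g (suc i) ∸ g i) + g 0 ≡ g k
sumBelow-telescope zero    g step = refl
sumBelow-telescope (suc k) g step = begin
  S + (g (suc k) ∸ g k) + g 0   ≡⟨ +-rearrange S (g (suc k) ∸ g k) (g 0) ⟩
  S + g 0 + (g (suc k) ∸ g k)   ≡⟨ cong (_+ (g (suc k) ∸ g k)) (sumBelow-telescope k g (λ i i<k → step i (m<n⇒m<1+n i<k))) ⟩
  g k + (g (suc k) ∸ g k)       ≡⟨ m+[n∸m]≡n (step k ≤-refl) ⟩
  g (suc k)                     ∎
  where
  open ≡-Reasoning
  S = sumBelow k (λ i → g (suc i) ∸ g i)

∑-telescope : ∀ N (g : ℕ → ℕ) → (∀ t → t < N → g (suc t) ≤ g t) → ∑ {N} (λ j → g (toℕ j) ∸ g (suc (toℕ j))) + g N ≡ g 0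
∑-telescope zero    g step = refl
∑-telescope (suc N) g step = begin
  (g 0 ∸ g 1) + S + g (suc N)   ≡⟨ +-assoc (g 0 ∸ g 1) S _ ⟩
  (g 0 ∸ g 1) + (S + g (suc N)) ≡⟨ cong ((g 0 ∸ g 1) +_) (∑-telescope N (λ t → g (suc t)) (λ t t<N → step (suc t) (s≤s t<N))) ⟩
  (g 0 ∸ g 1) + g 1             ≡⟨ m∸n+n≡m (step 0 (s≤s z≤n)) ⟩
  g 0                           ∎
  where
  open ≡-Reasoning
  S = ∑ {N} (λ j → g (suc (toℕ j)) ∸ g (suc (suc (toℕ j))))

psum-zero : ∀ {N} (c : Fin N → ℕ) → psum c 0 ≡ 0
psum-zero {zero}  c = refl
psum-zero {suc N} c = refl

psum-suc : ∀ {N} (c : Fin N → ℕ) k → psum c (suc k) ≡ psum c k + at c k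
psum-suc {zero}  c k       = refl
psum-suc {suc N} c zero    = trans (cong (c fzero +_) (psum-zero (λ i → c (fsuc i)))) (+-identityʳ (c fzero))
psum-suc {suc N} c (suc k) = trans (cong (c fzero +_) (psum-suc (λ i → c (fsuc i)) k)) (sym (+-assoc (c fzero) _ _))

psum-all : ∀ {N} (c : Fin N → ℕ) → psum c N ≡ ∑ c
psum-all {zero}  c = refl
psum-all {suc N} c = cong (c fzero +_) (psum-all (λ i → c (fsuc i)))

at≡psum-∸ : ∀ {N} (c : Fin N → ℕ) k → at c k ≡ psum c (suc k) ∸ psum c k
at≡psum-∸ c k = sym (trans (cong (_∸ psum c k) (psum-suc c k)) (m+n∸m≡n (psum c k) (at c k)))

psum-step : ∀ {N} (c : Fin N → ℕ) k → psum c k ≤ psum c (suc k)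
psum-step c k = subst (psum c k ≤_) (sym (psum-suc c k)) (m≤m+n (psum c k) (at c k))

sumBelow-at : ∀ {N} (c : Fin N → ℕ) k → sumBelow k (at c) ≡ psum c k
sumBelow-at c zero    = sym (psum-zero c)
sumBelow-at c (suc k) = trans (cong (_+ at c k) (sumBelow-at c k)) (sym (psum-suc c k))

-- The grid G(n,m)

rightᵇ downᵇ : ℕ → ℕ → ℕ → ℕ → Bool
rightᵇ k j k' j' = (k' ≡ᵇ k) ∧ (j' ≡ᵇ suc j)
downᵇ  k j k' j' = (k' ≡ᵇ suc k) ∧ (j' ≡ᵇ j)

rightᵇ⇒ : ∀ k j k' j' → rightᵇ k j k' j' ≡ true → k' ≡ k × j' ≡ suc j
rightᵇ⇒ k j k' j' r with ∧-true⇒ r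
... | k'≡k , j'≡1+j = ≡ᵇ-true⇒≡ {k'} {k} k'≡k , ≡ᵇ-true⇒≡ {j'} {suc j} j'≡1+j

downᵇ⇒ : ∀ k j k' j' → downᵇ k j k' j' ≡ true → k' ≡ suc k × j' ≡ j
downᵇ⇒ k j k' j' d with ∧-true⇒ d
... | k'≡1+k , j'≡j = ≡ᵇ-true⇒≡ {k'} {suc k} k'≡1+k , ≡ᵇ-true⇒≡ {j'} {j} j'≡j

rightᵇ⇒¬downᵇ : ∀ k j k' j' → rightᵇ k j k' j' ≡ true → downᵇ k j k' j' ≡ false
rightᵇ⇒¬downᵇ k j k' j' r =
  cong (_∧ (j' ≡ᵇ j)) (dec-false (k' ≟ suc k) (λ k'≡1+k → 1+n≢n (trans (sym k'≡1+k) (proj₁ (rightᵇ⇒ k j k' j' r)))))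

module Grid (n m : ℕ) where

  GridEdge : (i i' : Fin n) (j j' : Fin (suc m)) → Set
  GridEdge i i' j j' = Edge n m (inj₁ (i , j)) (inj₁ (i' , j'))

  module _ {i i' : Fin n} {j j' : Fin (suc m)} where
    private
      R = rightᵇ (toℕ i) (toℕ j) (toℕ i') (toℕ j')
      D = downᵇ (toℕ i) (toℕ j) (toℕ i') (toℕ j')

    edgeᵇ-sound : R ≡ true ⊎ D ≡ true → GridEdge i i' j j'
    edgeᵇ-sound (inj₁ r) with rightᵇ⇒ (toℕ i) (toℕ j) (toℕ i') (toℕ j') r
    ... | i'≡i , j'≡1+j = inj₁ (toℕ-injective (sym i'≡i) , j'≡1+j)
    edgeᵇ-sound (inj₂ d) with downᵇ⇒ (toℕ i) (toℕ j) (toℕ i') (toℕ j') d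
    ... | i'≡1+i , j'≡j = inj₂ (i'≡1+i , toℕ-injective (sym j'≡j))

    edgeᵇ-complete : GridEdge i i' j j' → R ≡ true ⊎ D ≡ true
    edgeᵇ-complete (inj₁ (refl , j'≡1+j)) =
      inj₁ (cong₂ _∧_ (dec-true (toℕ i ≟ toℕ i) refl) (dec-true (toℕ j' ≟ suc (toℕ j)) j'≡1+j))
    edgeᵇ-complete (inj₂ (i'≡1+i , refl)) =
      inj₂ (cong₂ _∧_ (dec-true (toℕ i' ≟ suc (toℕ i)) i'≡1+i) (dec-true (toℕ j ≟ toℕ j) refl))

  EdgeFunction : Set
  EdgeFunction = Vertex n m → Vertex n m → ℕ

  Supported : EdgeFunction → Set
  Supported f = ∀ u v → ¬ Edge n m u v → f u v ≡ 0

  support-split : ∀ {f} → Supported f → ∀ i j i' j' → let fuw = f (inj₁ (i , j)) (inj₁ (i' , j')) in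
    fuw ≡ when (rightᵇ (toℕ i) (toℕ j) (toℕ i') (toℕ j')) fuw + when (downᵇ (toℕ i) (toℕ j) (toℕ i') (toℕ j')) fuw
  support-split {f} sup i j i' j'
    with rightᵇ (toℕ i) (toℕ j) (toℕ i') (toℕ j') in r | downᵇ (toℕ i) (toℕ j) (toℕ i') (toℕ j') in d
  ... | true  | true  = ⊥-elim (true≢false (trans (sym d) (rightᵇ⇒¬downᵇ (toℕ i) (toℕ j) (toℕ i') (toℕ j') r)))
  ... | true  | false = sym (+-identityʳ _)
  ... | false | true  = refl
  ... | false | false = sup _ _ λ e →
    [ (λ r' → true≢false (trans (sym r') r)) , (λ d' → true≢false (trans (sym d') d)) ]′ (edgeᵇ-complete e)

  onGrid : EdgeFunction → Fin n → Fin (suc m) → Fin n → Fin (suc m) → ℕ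
  onGrid f i j i' j' = f (inj₁ (i , j)) (inj₁ (i' , j'))

  -- f on the grid edge (k , j) → (k' , j'), read as 0 when an end is off the grid.
  edgeAt : EdgeFunction → ℕ → ℕ → ℕ → ℕ → ℕ
  edgeAt f k j k' j' = at² (λ i jj → at² (onGrid f i jj) k' j') k j

  sinkAt : EdgeFunction → ℕ → ℕ → ℕ
  sinkAt f = at² (λ i jj → f (inj₁ (i , jj)) (inj₂ tt))

  right down vertOut : EdgeFunction → ℕ → ℕ → ℕ
  right f k j = edgeAt f k j k (suc j)
  down  f k j = edgeAt f k j (suc k) j
  vertOut f k j = down f k j + sinkAt f k j

  rightIn downIn : EdgeFunction → ℕ → ℕ → ℕ
  rightIn f k zero    = 0
  rightIn f k (suc j) = right f k j
  downIn f zero    j = 0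
  downIn f (suc k) j = down f k j

  edgeAt-toℕˡ : ∀ f i j k' j' → edgeAt f (toℕ i) (toℕ j) k' j' ≡ at² (onGrid f i j) k' j'
  edgeAt-toℕˡ f i j k' j' = at²-toℕ (λ i jj → at² (onGrid f i jj) k' j') i j

  edgeAt-toℕʳ : ∀ f k j i' j' → edgeAt f k j (toℕ i') (toℕ j') ≡ at² (λ i jj → onGrid f i jj i' j') k j
  edgeAt-toℕʳ f k j i' j' = at²-cong (λ i jj → at²-toℕ (onGrid f i jj) i' j') k j

  edgeAt-toℕ : ∀ f i j i' j' → edgeAt f (toℕ i) (toℕ j) (toℕ i') (toℕ j') ≡ f (inj₁ (i , j)) (inj₁ (i' , j'))
  edgeAt-toℕ f i j i' j' = trans (edgeAt-toℕˡ f i j (toℕ i') (toℕ j')) (at²-toℕ (onGrid f i j) i' j')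

  edgeAt-cong : ∀ {f g} → (∀ u v → f u v ≡ g u v) → ∀ k j k' j' → edgeAt f k j k' j' ≡ edgeAt g k j k' j'
  edgeAt-cong {f} {g} e k j k' j' =
    at²-cong {g = λ i jj → at² (onGrid f i jj) k' j'} (λ i jj → at²-cong (λ i' jj' → e (inj₁ (i , jj)) (inj₁ (i' , jj'))) k' j') k j

  right-last : ∀ f k → right f k m ≡ 0
  right-last f k = at²-zero (λ i jj → at²-≥ʳ (onGrid f i jj) k ≤-refl) k m

  down-last : ∀ f k j → n ≤ suc k → down f k j ≡ 0
  down-last f k j n≤1+k = at²-zero (λ i jj → at²-≥ˡ (onGrid f i jj) j n≤1+k) k j

  outflow : ∀ {f} → Supported f → ∀ i j → ∑V (f (inj₁ (i , j))) ≡ right f (toℕ i) (toℕ j) + vertOut f (toℕ i) (toℕ j)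
  outflow {f} sup i j = begin
    ∑ (λ i' → ∑ (F i')) + f u (inj₂ tt)
      ≡⟨ cong (_+ f u (inj₂ tt)) (trans (∑-cong (λ i' → ∑-cong (support-split sup i j i')))
                                          (∑²-distrib-+ (λ i' j' → when (rightᵇ k jn (toℕ i') (toℕ j')) (F i' j'))
                                                        (λ i' j' → when (downᵇ k jn (toℕ i') (toℕ j')) (F i' j')))) ⟩
    ∑ (λ i' → ∑ (λ j' → when (rightᵇ k jn (toℕ i') (toℕ j')) (F i' j')))
      + ∑ (λ i' → ∑ (λ j' → when (downᵇ k jn (toℕ i') (toℕ j')) (F i' j'))) + f u (inj₂ tt)
      ≡⟨ cong₂ (λ x y → x + y + f u (inj₂ tt)) (∑²-δ F k (suc jn)) (∑²-δ F (suc k) jn) ⟩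
    at² F k (suc jn) + at² F (suc k) jn + f u (inj₂ tt)
      ≡⟨ +-assoc (at² F k (suc jn)) _ _ ⟩
    at² F k (suc jn) + (at² F (suc k) jn + f u (inj₂ tt))
      ≡⟨ cong₂ (λ x y → x + (y + f u (inj₂ tt))) (edgeAt-toℕˡ f i j k (suc jn)) (edgeAt-toℕˡ f i j (suc k) jn) ⟨
    right f k jn + (down f k jn + f u (inj₂ tt))
      ≡⟨ cong (λ x → right f k jn + (down f k jn + x)) (at²-toℕ _ i j) ⟨
    right f k jn + vertOut f k jn ∎
    where
    open ≡-Reasoning
    k = toℕ i ; jn = toℕ j ; u = inj₁ (i , j)
    F = onGrid f i j

  private
    into : EdgeFunction → Fin n → Fin (suc m) → Fin n → Fin (suc m) → ℕ
    into f i' j' i j = onGrid f i j i' j'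

    inflow-right : ∀ f i' j' → ∑ (λ i → ∑ (λ j → when (rightᵇ (toℕ i) (toℕ j) (toℕ i') (toℕ j')) (into f i' j' i j)))
                               ≡ rightIn f (toℕ i') (toℕ j')
    inflow-right f i' j' with toℕ j' in eq
    ... | zero  = ∑-zero {n} (λ i → ∑-zero {suc m} (λ j → cong (λ b → when b (into f i' j' i j)) (∧-zeroʳ (toℕ i' ≡ᵇ toℕ i))))
    ... | suc y = trans (∑²-δʳ (into f i' j') (toℕ i') y)
                        (sym (trans (cong (edgeAt f (toℕ i') y (toℕ i')) (sym eq)) (edgeAt-toℕʳ f (toℕ i') y i' j')))

    inflow-down : ∀ f i' j' → ∑ (λ i → ∑ (λ j → when (downᵇ (toℕ i) (toℕ j) (toℕ i') (toℕ j')) (into f i' j' i j)))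
                              ≡ downIn f (toℕ i') (toℕ j')
    inflow-down f i' j' with toℕ i' in eq
    ... | zero  = ∑-zero {n} (λ i → ∑-zero {suc m} (λ j → refl))
    ... | suc x = trans (∑²-δʳ (into f i' j') x (toℕ j'))
                        (sym (trans (cong (λ z → edgeAt f x (toℕ j') z (toℕ j')) (sym eq)) (edgeAt-toℕʳ f x (toℕ j') i' j')))

  inflow : ∀ {f} → Supported f → ∀ i j → ∑V (λ v → f v (inj₁ (i , j))) ≡ rightIn f (toℕ i) (toℕ j) + downIn f (toℕ i) (toℕ j)
  inflow {f} sup i j = begin
    ∑ (λ i' → ∑ (into f i j i')) + f (inj₂ tt) (inj₁ (i , j))
      ≡⟨ cong₂ _+_ (trans (∑-cong (λ i' → ∑-cong (λ j' → support-split sup i' j' i j))) (∑²-distrib-+ R D)) (sup _ _ λ ()) ⟩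
    ∑ (λ i' → ∑ (R i')) + ∑ (λ i' → ∑ (D i')) + 0
      ≡⟨ +-identityʳ _ ⟩
    ∑ (λ i' → ∑ (R i')) + ∑ (λ i' → ∑ (D i'))
      ≡⟨ cong₂ _+_ (inflow-right f i j) (inflow-down f i j) ⟩
    rightIn f (toℕ i) (toℕ j) + downIn f (toℕ i) (toℕ j) ∎
    where
    open ≡-Reasoning
    R D : Fin n → Fin (suc m) → ℕ
    R i' j' = when (rightᵇ (toℕ i') (toℕ j') (toℕ i) (toℕ j)) (into f i j i' j')
    D i' j' = when (downᵇ (toℕ i') (toℕ j') (toℕ i) (toℕ j)) (into f i j i' j')

  horizontal vertical : (ℕ → ℕ → ℕ) → ℕ → ℕ → ℕ
  horizontal p k j = p (suc k) (suc j) ∸ p k (suc j)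
  vertical   p k j = p (suc k) j ∸ p (suc k) (suc j)

  flowOf : (ℕ → ℕ → ℕ) → EdgeFunction
  flowOf p (inj₁ (i , j)) (inj₁ (i' , j')) =
    when (rightᵇ (toℕ i) (toℕ j) (toℕ i') (toℕ j')) (horizontal p (toℕ i) (toℕ j)) +
    when (downᵇ  (toℕ i) (toℕ j) (toℕ i') (toℕ j')) (vertical   p (toℕ i) (toℕ j))
  flowOf p (inj₁ (i , j)) (inj₂ _) = when (suc (toℕ i) ≡ᵇ n) (vertical p (toℕ i) (toℕ j))
  flowOf p (inj₂ _)       _        = 0

  flowOf-supported : ∀ p → Supported (flowOf p)
  flowOf-supported p (inj₁ (i , j)) (inj₁ (i' , j')) ¬e
    with rightᵇ (toℕ i) (toℕ j) (toℕ i') (toℕ j') in r | downᵇ (toℕ i) (toℕ j) (toℕ i') (toℕ j') in d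
  ... | true  | _     = ⊥-elim (¬e (edgeᵇ-sound (inj₁ r)))
  ... | false | true  = ⊥-elim (¬e (edgeᵇ-sound (inj₂ d)))
  ... | false | false = refl
  flowOf-supported p (inj₁ (i , j)) (inj₂ _) ¬e = cong (λ b → when b (vertical p (toℕ i) (toℕ j))) (dec-false (suc (toℕ i) ≟ n) ¬e)
  flowOf-supported p (inj₂ _)       _        _  = refl

  edgeAt-flowOf : ∀ p {k j k' j'} → k < n → j ≤ m → k' < n → j' ≤ m →
    edgeAt (flowOf p) k j k' j' ≡ when (rightᵇ k j k' j') (horizontal p k j) + when (downᵇ k j k' j') (vertical p k j)
  edgeAt-flowOf p {k} {j} {k'} {j'} k<n j≤m k'<n j'≤m
    with toℕ-onto k k<n | toℕ-onto j (s≤s j≤m) | toℕ-onto k' k'<n | toℕ-onto j' (s≤s j'≤m)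
  ... | i , refl | jᶠ , refl | i' , refl | jᶠ' , refl = edgeAt-toℕ (flowOf p) i jᶠ i' jᶠ'

  right-flowOf : ∀ p {k j} → k < n → j < m → right (flowOf p) k j ≡ horizontal p k j
  right-flowOf p {k} {j} k<n j<m = begin
    right (flowOf p) k j
      ≡⟨ edgeAt-flowOf p k<n (<⇒≤ j<m) k<n j<m ⟩
    when ((k ≡ᵇ k) ∧ (j ≡ᵇ j)) (horizontal p k j) + when ((k ≡ᵇ suc k) ∧ (suc j ≡ᵇ j)) (vertical p k j)
      ≡⟨ cong₂ (λ x y → when (x ∧ (j ≡ᵇ j)) (horizontal p k j) + when (y ∧ (suc j ≡ᵇ j)) (vertical p k j))
               (dec-true (k ≟ k) refl) (dec-false (k ≟ suc k) (<⇒≢ (n<1+n k))) ⟩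
    when (j ≡ᵇ j) (horizontal p k j) + 0
      ≡⟨ cong (λ x → when x (horizontal p k j) + 0) (dec-true (j ≟ j) refl) ⟩
    horizontal p k j + 0
      ≡⟨ +-identityʳ _ ⟩
    horizontal p k j ∎
    where open ≡-Reasoning

  down-flowOf : ∀ p {k j} → suc k < n → j ≤ m → down (flowOf p) k j ≡ vertical p k j
  down-flowOf p {k} {j} 1+k<n j≤m = begin
    down (flowOf p) k j
      ≡⟨ edgeAt-flowOf p (<-trans (n<1+n k) 1+k<n) j≤m 1+k<n j≤m ⟩
    when ((suc k ≡ᵇ k) ∧ (j ≡ᵇ suc j)) (horizontal p k j) + when ((k ≡ᵇ k) ∧ (j ≡ᵇ j)) (vertical p k j)
      ≡⟨ cong₂ (λ x y → when (x ∧ (j ≡ᵇ suc j)) (horizontal p k j) + when (y ∧ (j ≡ᵇ j)) (vertical p k j))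
               (dec-false (suc k ≟ k) 1+n≢n) (dec-true (k ≟ k) refl) ⟩
    when (j ≡ᵇ j) (vertical p k j)
      ≡⟨ cong (λ x → when x (vertical p k j)) (dec-true (j ≟ j) refl) ⟩
    vertical p k j ∎
    where open ≡-Reasoning

  vertOut-flowOf : ∀ p {k j} → k < n → j ≤ m → vertOut (flowOf p) k j ≡ vertical p k j
  vertOut-flowOf p {k} {j} k<n j≤m with toℕ-onto k k<n | toℕ-onto j (s≤s j≤m)
  ... | i , refl | jᶠ , refl with m≤n⇒m<n∨m≡n k<n
  ...   | inj₁ 1+k<n = begin
    down (flowOf p) k j + sinkAt (flowOf p) k j  ≡⟨ cong₂ _+_ (down-flowOf p 1+k<n j≤m) (at²-toℕ _ i jᶠ) ⟩
    vertical p k j + when (suc k ≡ᵇ n) (vertical p k j)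
      ≡⟨ cong (λ b → vertical p k j + when b (vertical p k j)) (dec-false (suc k ≟ n) (<⇒≢ 1+k<n)) ⟩
    vertical p k j + 0                                ≡⟨ +-identityʳ _ ⟩
    vertical p k j                                    ∎
    where open ≡-Reasoning
  ...   | inj₂ 1+k≡n = begin
    down (flowOf p) k j + sinkAt (flowOf p) k j  ≡⟨ cong₂ _+_ (down-last (flowOf p) k j (≤-reflexive (sym 1+k≡n))) (at²-toℕ _ i jᶠ) ⟩
    when (suc k ≡ᵇ n) (vertical p k j)           ≡⟨ cong (λ b → when b (vertical p k j)) (dec-true (suc k ≟ n) 1+k≡n) ⟩
    vertical p k j                               ∎
    where open ≡-Reasoning

-- Cut tables and flows

module Cuts (n m : ℕ) (a b : Fin n → ℕ) where
  open Grid n m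

  record IsCutTable (p : ℕ → ℕ → ℕ) : Set where
    field
      source-column : ∀ {k} → k ≤ n → p k 0 ≡ psum a k
      sink-column   : ∀ {k} → k ≤ n → p k (suc m) ≡ psum b k
      top-row       : ∀ t → p 0 t ≡ 0
      antitone-step : ∀ {k t} → k ≤ n → t ≤ m → p k (suc t) ≤ p k t
      monotone-step : ∀ {k t} → k < n → t ≤ suc m → p k t ≤ p (suc k) t

    antitone : ∀ {k t t'} → k ≤ n → t ≤ t' → t' ≤ suc m → p k t' ≤ p k t
    antitone {k} k≤n =
      stepwise {R = flip _≤_} ≤-refl (flip ≤-trans) (p k) (suc m) (λ t t<1+m → antitone-step k≤n (≤-pred t<1+m))

    monotone : ∀ {k k' t} → k ≤ k' → k' ≤ n → t ≤ suc m → p k t ≤ p k' t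
    monotone {t = t} k≤k' k'≤n t≤1+m =
      stepwise {R = _≤_} ≤-refl ≤-trans (λ k → p k t) n (λ k k<n → monotone-step k<n t≤1+m) k≤k' k'≤n

    lower-bound : ∀ {k t} → k ≤ n → t ≤ suc m → psum b k ≤ p k t
    lower-bound k≤n t≤1+m = subst (_≤ _) (sink-column k≤n) (antitone k≤n t≤1+m ≤-refl)

    upper-bound : ∀ {k t} → k ≤ n → t ≤ suc m → p k t ≤ psum a k
    upper-bound k≤n t≤1+m = subst (_ ≤_) (source-column k≤n) (antitone k≤n z≤n t≤1+m)

  _≐_ : (p q : ℕ → ℕ → ℕ) → Set
  p ≐ q = ∀ {k t} → k ≤ n → t ≤ suc m → p k t ≡ q k t

  target : ℕ → ℕ → ℕ
  target k j = when (j ≡ᵇ m) (at b k)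

  target-interior : ∀ k {j} → j < m → target k j ≡ 0
  target-interior k {j} j<m = cong (λ x → when x (at b k)) (dec-false (j ≟ m) (<⇒≢ j<m))

  -- What row k carries from column t ∸ 1 to column t; at t = 0 this is the supply a_k,
  -- at t = m + 1 the demand b_k handed to the sink.
  crossing : EdgeFunction → ℕ → ℕ → ℕ
  crossing f k zero    = at a k
  crossing f k (suc j) = right f k j + target k j

  cut : EdgeFunction → ℕ → ℕ → ℕ
  cut f k t = sumBelow k (λ k' → crossing f k' t)

  LocalBalance : EdgeFunction → ℕ → ℕ → Set
  LocalBalance f k j = crossing f k (suc j) + vertOut f k j ≡ crossing f k j + downIn f k j

  Conserves : EdgeFunction → Vertex n m → Set
  Conserves f v = (ℤ.+ ∑V (f v)) ℤ.- (ℤ.+ ∑V (λ w → f w v)) ≡ demand m a b v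

  conserves⇔balance : ∀ {f} → Supported f → ∀ i j → Conserves f (inj₁ (i , j)) ⇔ LocalBalance f (toℕ i) (toℕ j)
  conserves⇔balance {f} sup i j =
    mk⇔ (λ e → trans (sym outgoing) (trans e incoming)) (λ e → trans outgoing (trans e (sym incoming)))
      ⇔-∘ ℤ-diff-≡⇔ out in′ src tgt
    where
    open ≡-Reasoning
    k = toℕ i ; jn = toℕ j
    out = ∑V (f (inj₁ (i , j))) ; in′ = ∑V (λ w → f w (inj₁ (i , j)))
    src = when (jn ≡ᵇ 0) (a i) ; tgt = when (jn ≡ᵇ m) (b i)
    outgoing : out + tgt ≡ crossing f k (suc jn) + vertOut f k jn
    outgoing = begin
      out + tgt                                 ≡⟨ cong (_+ tgt) (outflow sup i j) ⟩
      right f k jn + vertOut f k jn + tgt       ≡⟨ +-rearrange (right f k jn) (vertOut f k jn) tgt ⟩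
      right f k jn + tgt + vertOut f k jn       ≡⟨ cong (λ x → right f k jn + when (jn ≡ᵇ m) x + vertOut f k jn) (at-toℕ b i) ⟨
      crossing f k (suc jn) + vertOut f k jn    ∎
    source : crossing f k jn ≡ src + rightIn f k jn
    source with jn | toℕ<n j
    ... | zero  | _         = trans (at-toℕ a i) (sym (+-identityʳ (a i)))
    ... | suc y | s≤s 1+y≤m = trans (cong (right f k y +_) (target-interior k 1+y≤m)) (+-identityʳ _)
    incoming : src + in′ ≡ crossing f k jn + downIn f k jn
    incoming = begin
      src + in′                                     ≡⟨ cong (src +_) (inflow sup i j) ⟩
      src + (rightIn f k jn + downIn f k jn)        ≡⟨ +-assoc src _ _ ⟨
      src + rightIn f k jn + downIn f k jn          ≡⟨ cong (_+ downIn f k jn) source ⟨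
      crossing f k jn + downIn f k jn               ∎

  leaving : EdgeFunction → ℕ → ℕ → ℕ
  leaving f zero    j = 0
  leaving f (suc k) j = vertOut f k j

  sinkAt-interior : ∀ {f} → Supported f → ∀ {k j} → suc k < n → j ≤ m → sinkAt f k j ≡ 0
  sinkAt-interior {f} sup {k} {j} 1+k<n j≤m with toℕ-onto k (<-trans (n<1+n k) 1+k<n) | toℕ-onto j (s≤s j≤m)
  ... | i , refl | jᶠ , refl = trans (at²-toℕ _ i jᶠ) (sup _ _ (<⇒≢ 1+k<n))

  downIn≡leaving : ∀ {f} → Supported f → ∀ {k j} → k < n → j ≤ m → downIn f k j ≡ leaving f k j
  downIn≡leaving sup {zero}  k<n j≤m = refl
  downIn≡leaving {f} sup {suc k} {j} k<n j≤m = sym (trans (cong (down f k j +_) (sinkAt-interior sup k<n j≤m)) (+-identityʳ _))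

  module _ (F : IntegralFlow n m a b) where
    private
      f = IntegralFlow.f F
      sup = IntegralFlow.support F

    balance : ∀ {k j} → k < n → j ≤ m → LocalBalance f k j
    balance {k} {j} k<n j≤m with toℕ-onto k k<n | toℕ-onto j (s≤s j≤m)
    ... | i , refl | jᶠ , refl = Equivalence.to (conserves⇔balance sup i jᶠ) (IntegralFlow.conserve F (inj₁ (i , jᶠ)))

    cut-column : ∀ {k j} → k ≤ n → j ≤ m → leaving f k j + cut f k (suc j) ≡ cut f k j
    cut-column {zero}  {j} _   j≤m = refl
    cut-column {suc k} {j} k<n j≤m = begin
      vertOut f k j + (cut f k (suc j) + crossing f k (suc j))  ≡⟨ +-rotate (vertOut f k j) (cut f k (suc j)) (crossing f k (suc j)) ⟩
      crossing f k (suc j) + vertOut f k j + cut f k (suc j)    ≡⟨ cong (_+ cut f k (suc j)) (balance k<n j≤m) ⟩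
      crossing f k j + downIn f k j + cut f k (suc j)           ≡⟨ +-assoc (crossing f k j) _ _ ⟩
      crossing f k j + (downIn f k j + cut f k (suc j))         ≡⟨ cong (λ x → crossing f k j + (x + cut f k (suc j))) (downIn≡leaving sup k<n j≤m) ⟩
      crossing f k j + (leaving f k j + cut f k (suc j))        ≡⟨ cong (crossing f k j +_) (cut-column (<⇒≤ k<n) j≤m) ⟩
      crossing f k j + cut f k j                                ≡⟨ +-comm (crossing f k j) _ ⟩
      cut f k j + crossing f k j                                ∎
      where open ≡-Reasoning

    cut-isCutTable : IsCutTable (cut f)
    cut-isCutTable = record
      { source-column = λ {k} _ → sumBelow-at a k
      ; sink-column   = λ {k} _ → trans (sumBelow-cong k (λ k' _ → sink-crossing k')) (sumBelow-at b k)
      ; top-row       = λ t → refl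
      ; antitone-step = λ {k} {t} k≤n t≤m → subst (cut f k (suc t) ≤_) (cut-column k≤n t≤m) (m≤n+m _ (leaving f k t))
      ; monotone-step = λ {k} {t} _ _ → m≤m+n (cut f k t) (crossing f k t)
      }
      where
      sink-crossing : ∀ k → crossing f k (suc m) ≡ at b k
      sink-crossing k = cong₂ _+_ (right-last f k) (cong (λ x → when x (at b k)) (dec-true (m ≟ m) refl))

    horizontal-cut : ∀ k j → horizontal (cut f) k j ≡ crossing f k (suc j)
    horizontal-cut k j = m+n∸m≡n (cut f k (suc j)) _

    vertical-cut : ∀ {k j} → k < n → j ≤ m → vertical (cut f) k j ≡ vertOut f k j
    vertical-cut {k} {j} k<n j≤m =
      trans (cong (_∸ cut f (suc k) (suc j)) (sym (cut-column k<n j≤m))) (m+n∸n≡m (vertOut f k j) (cut f (suc k) (suc j)))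

    horizontal-cut-edge : ∀ i j i' j' → rightᵇ (toℕ i) (toℕ j) (toℕ i') (toℕ j') ≡ true →
                          horizontal (cut f) (toℕ i) (toℕ j) ≡ f (inj₁ (i , j)) (inj₁ (i' , j'))
    horizontal-cut-edge i j i' j' r with rightᵇ⇒ (toℕ i) (toℕ j) (toℕ i') (toℕ j') r
    ... | i'≡i , j'≡1+j = begin
      horizontal (cut f) k jn            ≡⟨ horizontal-cut k jn ⟩
      right f k jn + target k jn         ≡⟨ cong (right f k jn +_) (target-interior k (subst (_≤ m) j'≡1+j (≤-pred (toℕ<n j')))) ⟩
      right f k jn + 0                   ≡⟨ +-identityʳ _ ⟩
      edgeAt f k jn k (suc jn)           ≡⟨ cong₂ (edgeAt f k jn) i'≡i j'≡1+j ⟨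
      edgeAt f k jn (toℕ i') (toℕ j')    ≡⟨ edgeAt-toℕ f i j i' j' ⟩
      f (inj₁ (i , j)) (inj₁ (i' , j'))  ∎
      where
      open ≡-Reasoning
      k = toℕ i ; jn = toℕ j

    vertical-cut-edge : ∀ i j i' j' → downᵇ (toℕ i) (toℕ j) (toℕ i') (toℕ j') ≡ true →
                        vertical (cut f) (toℕ i) (toℕ j) ≡ f (inj₁ (i , j)) (inj₁ (i' , j'))
    vertical-cut-edge i j i' j' d with downᵇ⇒ (toℕ i) (toℕ j) (toℕ i') (toℕ j') d
    ... | i'≡1+i , j'≡j = begin
      vertical (cut f) k jn              ≡⟨ vertical-cut (toℕ<n i) (≤-pred (toℕ<n j)) ⟩
      down f k jn + sinkAt f k jn        ≡⟨ cong (down f k jn +_) (sinkAt-interior sup (subst (_< n) i'≡1+i (toℕ<n i')) (≤-pred (toℕ<n j))) ⟩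
      down f k jn + 0                    ≡⟨ +-identityʳ _ ⟩
      edgeAt f k jn (suc k) jn           ≡⟨ cong₂ (edgeAt f k jn) i'≡1+i j'≡j ⟨
      edgeAt f k jn (toℕ i') (toℕ j')    ≡⟨ edgeAt-toℕ f i j i' j' ⟩
      f (inj₁ (i , j)) (inj₁ (i' , j'))  ∎
      where
      open ≡-Reasoning
      k = toℕ i ; jn = toℕ j

    flowOf-cut : ∀ u v → flowOf (cut f) u v ≡ f u v
    flowOf-cut (inj₁ (i , j)) (inj₁ (i' , j')) =
      trans (cong₂ _+_ (when-cong (horizontal-cut-edge i j i' j')) (when-cong (vertical-cut-edge i j i' j')))
            (sym (support-split sup i j i' j'))
    flowOf-cut (inj₁ (i , j)) (inj₂ tt) with suc (toℕ i) ≡ᵇ n in last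
    ... | true  = begin
      vertical (cut f) (toℕ i) (toℕ j)                    ≡⟨ vertical-cut (toℕ<n i) (≤-pred (toℕ<n j)) ⟩
      down f (toℕ i) (toℕ j) + sinkAt f (toℕ i) (toℕ j)
        ≡⟨ cong₂ _+_ (down-last f (toℕ i) (toℕ j) (≤-reflexive (sym (≡ᵇ-true⇒≡ {suc (toℕ i)} {n} last)))) (at²-toℕ _ i j) ⟩
      f (inj₁ (i , j)) (inj₂ tt)                          ∎
      where open ≡-Reasoning
    ... | false = sym (sup _ _ (λ e → true≢false (trans (sym (dec-true (suc (toℕ i) ≟ n) e)) last)))
    flowOf-cut (inj₂ tt) v = sym (sup _ _ (λ ()))

  module _ {p : ℕ → ℕ → ℕ} (table : IsCutTable p) where
    open IsCutTable table

    crossing-flowOf : ∀ {k t} → k < n → t ≤ suc m → crossing (flowOf p) k t ≡ p (suc k) t ∸ p k t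
    crossing-flowOf {k} {zero} k<n _ =
      trans (at≡psum-∸ a k) (sym (cong₂ _∸_ (source-column k<n) (source-column (<⇒≤ k<n))))
    crossing-flowOf {k} {suc j} k<n (s≤s j≤m) with m≤n⇒m<n∨m≡n j≤m
    ... | inj₁ j<m = trans (cong₂ _+_ (right-flowOf p k<n j<m) (target-interior k j<m)) (+-identityʳ _)
    ... | inj₂ refl = begin
      right (flowOf p) k m + target k m  ≡⟨ cong₂ _+_ (right-last (flowOf p) k) (cong (λ x → when x (at b k)) (dec-true (m ≟ m) refl)) ⟩
      at b k                             ≡⟨ at≡psum-∸ b k ⟩
      psum b (suc k) ∸ psum b k          ≡⟨ cong₂ _∸_ (sink-column k<n) (sink-column (<⇒≤ k<n)) ⟨
      p (suc k) (suc m) ∸ p k (suc m)    ∎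
      where open ≡-Reasoning

    downIn-flowOf : ∀ {k j} → k < n → j ≤ m → downIn (flowOf p) k j ≡ p k j ∸ p k (suc j)
    downIn-flowOf {zero}  {j} _   _   = sym (cong₂ _∸_ (top-row j) (top-row (suc j)))
    downIn-flowOf {suc k} {j} k<n j≤m = down-flowOf p k<n j≤m

    balance-flowOf : ∀ {k j} → k < n → j ≤ m → LocalBalance (flowOf p) k j
    balance-flowOf {k} {j} k<n j≤m = begin
      crossing (flowOf p) k (suc j) + vertOut (flowOf p) k j
        ≡⟨ cong₂ _+_ (crossing-flowOf k<n (s≤s j≤m)) (vertOut-flowOf p k<n j≤m) ⟩
      (p (suc k) (suc j) ∸ p k (suc j)) + (p (suc k) j ∸ p (suc k) (suc j))
        ≡⟨ +-comm (p (suc k) (suc j) ∸ p k (suc j)) _ ⟩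
      (p (suc k) j ∸ p (suc k) (suc j)) + (p (suc k) (suc j) ∸ p k (suc j))
        ≡⟨ ∸-telescope (monotone-step k<n (s≤s j≤m)) (antitone-step k<n j≤m) ⟩
      p (suc k) j ∸ p k (suc j)
        ≡⟨ ∸-telescope (antitone-step (<⇒≤ k<n) j≤m) (monotone-step k<n (m≤n⇒m≤1+n j≤m)) ⟨
      (p (suc k) j ∸ p k j) + (p k j ∸ p k (suc j))
        ≡⟨ cong₂ _+_ (crossing-flowOf k<n (m≤n⇒m≤1+n j≤m)) (downIn-flowOf k<n j≤m) ⟨
      crossing (flowOf p) k j + downIn (flowOf p) k j ∎
      where open ≡-Reasoning

    sink-inflow : 1 ≤ n → ∑V (λ w → flowOf p w (inj₂ tt)) + p n (suc m) ≡ p n 0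
    sink-inflow 1≤n = begin
      inflow′ + 0 + p n (suc m)
        ≡⟨ cong (_+ p n (suc m)) (+-identityʳ inflow′) ⟩
      inflow′ + p n (suc m)
        ≡⟨ cong (_+ p n (suc m)) (trans (∑-cong {n} (λ i → ∑-when {suc m} (suc (toℕ i) ≡ᵇ n) (λ j → vertical p (toℕ i) (toℕ j))))
                                       (∑-δ-last {n} (λ i → column (toℕ i)))) ⟩
      at {n} (λ i → column (toℕ i)) (n ∸ 1) + p n (suc m)
        ≡⟨ cong (_+ p n (suc m)) (at-∘toℕ column (∸-monoʳ-< {n} {1} {0} (s≤s z≤n) 1≤n)) ⟩
      column (n ∸ 1) + p n (suc m)
        ≡⟨ cong (λ k → ∑ {suc m} (λ j → p k (toℕ j) ∸ p k (suc (toℕ j))) + p n (suc m)) (m+[n∸m]≡n 1≤n) ⟩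
      ∑ {suc m} (λ j → p n (toℕ j) ∸ p n (suc (toℕ j))) + p n (suc m)
        ≡⟨ ∑-telescope (suc m) (p n) (λ t t<1+m → antitone-step ≤-refl (≤-pred t<1+m)) ⟩
      p n 0 ∎
      where
      open ≡-Reasoning
      inflow′ = ∑ {n} (λ i → ∑ {suc m} (λ j → when (suc (toℕ i) ≡ᵇ n) (vertical p (toℕ i) (toℕ j))))
      column : ℕ → ℕ
      column k = ∑ {suc m} (λ j → vertical p k (toℕ j))

    sink-conserves : 1 ≤ n → Conserves (flowOf p) (inj₂ tt)
    sink-conserves 1≤n = Equivalence.from (ℤ-diff-≡⇔ _ _ (∑ b) (∑ a)) (begin
      ∑V (flowOf p (inj₂ tt)) + ∑ a
        ≡⟨ cong₂ _+_ (cong (_+ 0) (∑-zero {n} (λ i → ∑-zero {suc m} (λ j → refl)))) (sym (psum-all a)) ⟩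
      psum a n
        ≡⟨ trans (sym (source-column ≤-refl)) (sym (sink-inflow 1≤n)) ⟩
      into-sink + p n (suc m)
        ≡⟨ cong (into-sink +_) (trans (sink-column ≤-refl) (psum-all b)) ⟩
      into-sink + ∑ b
        ≡⟨ +-comm into-sink (∑ b) ⟩
      ∑ b + into-sink ∎)
      where
      open ≡-Reasoning
      into-sink = ∑V (λ w → flowOf p w (inj₂ tt))

    flowOf-flow : 1 ≤ n → IntegralFlow n m a b
    flowOf-flow 1≤n = record
      { f        = flowOf p
      ; support  = flowOf-supported p
      ; conserve = conserve
      }
      where
      conserve : ∀ v → Conserves (flowOf p) v
      conserve (inj₁ (i , j)) = Equivalence.from (conserves⇔balance (flowOf-supported p) i j)
                                                 (balance-flowOf (toℕ<n i) (≤-pred (toℕ<n j)))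
      conserve (inj₂ tt) = sink-conserves 1≤n

    cut-flowOf : cut (flowOf p) ≐ p
    cut-flowOf {k} {t} k≤n t≤1+m = begin
      sumBelow k (λ k' → crossing (flowOf p) k' t)  ≡⟨ sumBelow-cong k (λ k' k'<k → crossing-flowOf (<-≤-trans k'<k k≤n) t≤1+m) ⟩
      S                                             ≡⟨ +-identityʳ S ⟨
      S + 0                                         ≡⟨ cong (S +_) (top-row t) ⟨
      S + p 0 t                                     ≡⟨ sumBelow-telescope k (λ k' → p k' t) increasing ⟩
      p k t                                         ∎
      where
      open ≡-Reasoning
      S = sumBelow k (λ k' → p (suc k') t ∸ p k' t)
      increasing : ∀ k' → k' < k → p k' t ≤ p (suc k') t
      increasing k' k'<k = monotone-step (<-≤-trans k'<k k≤n) t≤1+m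

  module _ {p q : ℕ → ℕ → ℕ} (p≐q : p ≐ q) where

    flowOf-cong : ∀ u v → flowOf p u v ≡ flowOf q u v
    flowOf-cong (inj₁ (i , j)) (inj₁ (i' , j')) =
      cong₂ _+_ (cong (when (rightᵇ (toℕ i) (toℕ j) (toℕ i') (toℕ j'))) horizontal-cong)
                (cong (when (downᵇ (toℕ i) (toℕ j) (toℕ i') (toℕ j'))) vertical-cong)
      where
      k<n = toℕ<n i ; 1+j≤1+m = toℕ<n j
      horizontal-cong : horizontal p (toℕ i) (toℕ j) ≡ horizontal q (toℕ i) (toℕ j)
      horizontal-cong = cong₂ _∸_ (p≐q k<n 1+j≤1+m) (p≐q (<⇒≤ k<n) 1+j≤1+m)
      vertical-cong : vertical p (toℕ i) (toℕ j) ≡ vertical q (toℕ i) (toℕ j)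
      vertical-cong = cong₂ _∸_ (p≐q k<n (m≤n⇒m≤1+n (≤-pred 1+j≤1+m))) (p≐q k<n 1+j≤1+m)
    flowOf-cong (inj₁ (i , j)) (inj₂ tt) =
      cong (when (suc (toℕ i) ≡ᵇ n)) (cong₂ _∸_ (p≐q (toℕ<n i) (m≤n⇒m≤1+n (≤-pred (toℕ<n j)))) (p≐q (toℕ<n i) (toℕ<n j)))
    flowOf-cong (inj₂ tt) v = refl

  cut-cong : ∀ {f g} → (∀ u v → f u v ≡ g u v) → ∀ k t → cut f k t ≡ cut g k t
  cut-cong {f} {g} f≗g k t = sumBelow-cong k (λ k' _ → crossing-cong k' t)
    where
    crossing-cong : ∀ k t → crossing f k t ≡ crossing g k t
    crossing-cong k zero    = refl
    crossing-cong k (suc j) = cong (_+ target k j) (edgeAt-cong f≗g k j k (suc j))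

-- Plane partitions and cut tables

module Diagrams (n m : ℕ) (a b : Fin n → ℕ) where
  open Cuts n m a b using (IsCutTable; module IsCutTable; _≐_)
  open PlanePartition

  -- Row r of θ(a , b) is (psum b k , psum a k] with k = n ∸ toℕ r, so InCell a b r is InRow (n ∸ toℕ r).
  InRow : ℕ → ℕ → Set
  InRow k c = psum b k < c × c ≤ psum a k

  InRow⇔InInterval : ∀ {k c} → InRow k c ⇔ InInterval (psum b k) (psum a k ∸ psum b k) c
  InRow⇔InInterval {k} {c} = mk⇔ to from
    where
    B = psum b k ; A = psum a k
    to : InRow k c → InInterval B (A ∸ B) c
    to (B<c , c≤A) = B<c , subst (c ≤_) (sym (m+[n∸m]≡n (≤-trans (<⇒≤ B<c) c≤A))) c≤A
    from : InInterval B (A ∸ B) c → InRow k c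
    from (B<c , c≤) with B ≤? A
    ... | yes B≤A = B<c , subst (c ≤_) (m+[n∸m]≡n B≤A) c≤
    ... | no  B≰A = ⊥-elim (<⇒≱ B<c (subst (c ≤_) (trans (cong (B +_) (m≤n⇒m∸n≡0 (<⇒≤ (≰⇒> B≰A)))) (+-identityʳ B)) c≤))

  cellValue : PlanePartition n m a b → Fin n → ℕ → ℕ
  cellValue P r c with shapeOf b r <? c | c ≤? shapeOf a r
  ... | yes μ<c | yes c≤λ = π P r c (μ<c , c≤λ)
  ... | _       | _       = 0

  cellValue-π : ∀ P {r c} (x : InCell a b r c) → cellValue P r c ≡ π P r c x
  cellValue-π P {r} {c} (μ<c , c≤λ) with shapeOf b r <? c | c ≤? shapeOf a r
  ... | yes μ<c′ | yes c≤λ′ = cong (π P r c) (cong₂ _,_ (<-irrelevant μ<c′ μ<c) (≤-irrelevant c≤λ′ c≤λ))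
  ... | no μ≮c   | _        = ⊥-elim (μ≮c μ<c)
  ... | yes _    | no c≰λ   = ⊥-elim (c≰λ c≤λ)

  cellValue-≤ : ∀ P r c → cellValue P r c ≤ m
  cellValue-≤ P r c with shapeOf b r <? c | c ≤? shapeOf a r
  ... | yes μ<c | yes c≤λ = bounded P r c (μ<c , c≤λ)
  ... | yes _   | no _    = z≤n
  ... | no _    | _       = z≤n

  cellValue-cong : ∀ {P Q} → (∀ r c x → π P r c x ≡ π Q r c x) → ∀ r c → cellValue P r c ≡ cellValue Q r c
  cellValue-cong P≈Q r c with shapeOf b r <? c | c ≤? shapeOf a r
  ... | yes μ<c | yes c≤λ = P≈Q r c (μ<c , c≤λ)
  ... | yes _   | no _    = refl
  ... | no _    | _       = refl

  -- The entries of P indexed by k = n ∸ toℕ r, i.e. counting rows from the bottom.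
  entry : PlanePartition n m a b → ℕ → ℕ → ℕ
  entry P k c = at (λ r → cellValue P r c) (n ∸ k)

  entry-row : ∀ P r c → entry P (n ∸ toℕ r) c ≡ cellValue P r c
  entry-row P r c = trans (cong (at (λ r → cellValue P r c)) (m∸[m∸n]≡n (<⇒≤ (toℕ<n r)))) (at-toℕ _ r)

  entry-≤ : ∀ P k c → entry P k c ≤ m
  entry-≤ P k c = at-≤ (λ r → cellValue-≤ P r c) (n ∸ k)

  entry-cong : ∀ {P Q} → (∀ r c x → π P r c x ≡ π Q r c x) → ∀ k c → entry P k c ≡ entry Q k c
  entry-cong P≈Q k c = at-cong (λ r → cellValue-cong P≈Q r c) (n ∸ k)

  row-index : ∀ {k} → 1 ≤ k → k ≤ n → Σ (Fin n) (λ r → n ∸ toℕ r ≡ k)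
  row-index {k} 1≤k k≤n with toℕ-onto (n ∸ k) (∸-monoʳ-< {n} {k} {0} 1≤k k≤n)
  ... | r , r≡n∸k = r , trans (cong (n ∸_) r≡n∸k) (m∸[m∸n]≡n k≤n)

  entry-π : ∀ P {r c} (x : InCell a b r c) → entry P (n ∸ toℕ r) c ≡ π P r c x
  entry-π P {r} {c} x = trans (entry-row P r c) (cellValue-π P x)

  entry-antitone : ∀ P {k c c'} → 1 ≤ k → k ≤ n → InRow k c → InRow k c' → c ≤ c' → entry P k c' ≤ entry P k c
  entry-antitone P 1≤k k≤n x x' c≤c' with row-index 1≤k k≤n
  ... | r , refl = subst₂ _≤_ (sym (entry-π P x')) (sym (entry-π P x)) (rowDec P r _ _ x x' c≤c')

  entry-monotone : ∀ P {k c} → 1 ≤ k → suc k ≤ n → InRow k c → InRow (suc k) c → entry P k c ≤ entry P (suc k) c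
  entry-monotone P {c = c} 1≤k 1+k≤n x x' with row-index 1≤k (<⇒≤ 1+k≤n) | row-index (s≤s z≤n) 1+k≤n
  ... | r , refl | r' , r'-below = subst (λ k' → entry P (n ∸ toℕ r) c ≤ entry P k' c) r'-below
    (subst₂ _≤_ (sym (entry-π P x)) (sym (entry-π P x'′)) (colDec P r' r c x'′ x r'≤r))
    where
    x'′ : InCell a b r' c
    x'′ = subst (λ k' → InRow k' c) (sym r'-below) x'
    r'≤r : toℕ r' ≤ toℕ r
    r'≤r = ≮⇒≥ (λ r<r' → 1+n≰n (subst (_≤ n ∸ toℕ r) r'-below (∸-monoʳ-≤ n (<⇒≤ r<r'))))

  tableOf : PlanePartition n m a b → ℕ → ℕ → ℕ
  tableOf P k t = psum b k + count (λ c → t ≤? entry P k c) (psum b k) (psum a k ∸ psum b k)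

  tableOf-galois : ∀ P {k t c} → 1 ≤ k → k ≤ n → InRow k c → t ≤ entry P k c ⇔ c ≤ tableOf P k t
  tableOf-galois P {k} {t} 1≤k k≤n x =
    count-galois (λ c → t ≤? entry P k c) (psum b k) (psum a k ∸ psum b k) closed (Equivalence.to InRow⇔InInterval x)
    where
    closed : DownClosedOn (λ c → t ≤ entry P k c) (psum b k) (psum a k ∸ psum b k)
    closed {c} {c'} B<c c≤c' c'≤ t≤e = ≤-trans t≤e
      (entry-antitone P 1≤k k≤n (Equivalence.from InRow⇔InInterval (B<c , ≤-trans c≤c' c'≤))
                                (Equivalence.from InRow⇔InInterval (<-≤-trans B<c c≤c' , c'≤)) c≤c')

  tableOf-top : ∀ P t → tableOf P 0 t ≡ 0
  tableOf-top P t rewrite psum-zero a | psum-zero b = refl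

  tableOf-upper : ∀ P {k t} → psum b k ≤ psum a k → tableOf P k t ≤ psum a k
  tableOf-upper P {k} {t} B≤A =
    subst (tableOf P k t ≤_) (m+[n∸m]≡n B≤A) (+-monoʳ-≤ (psum b k) (count-≤ (λ c → t ≤? entry P k c) (psum b k) (psum a k ∸ psum b k)))

  tableOf-source : ∀ P {k} → psum b k ≤ psum a k → tableOf P k 0 ≡ psum a k
  tableOf-source P {k} B≤A = trans (cong (psum b k +_) (count-all _ (psum b k) (psum a k ∸ psum b k) (λ _ _ → z≤n))) (m+[n∸m]≡n B≤A)

  tableOf-sink : ∀ P k → tableOf P k (suc m) ≡ psum b k
  tableOf-sink P k =
    trans (cong (psum b k +_) (count-none _ (psum b k) (psum a k ∸ psum b k) (λ c _ 1+m≤e → 1+n≰n (≤-trans 1+m≤e (entry-≤ P k c)))))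
          (+-identityʳ (psum b k))

  -- y = tableOf P k t is either at most b₁ + ⋯ + b_{k+1}, or a cell of rows k and k + 1;
  -- then t ≤ (entry of row k at y) ≤ (entry of row k + 1 at y), by decrease down columns.
  tableOf-monotone-step : ∀ P {k t} → a ⊵ b → k < n → tableOf P k t ≤ tableOf P (suc k) t
  tableOf-monotone-step P {zero}  {t} a⊵b _ = subst (_≤ tableOf P 1 t) (sym (tableOf-top P t)) z≤n
  tableOf-monotone-step P {suc k} {t} a⊵b 1+k<n with tableOf P (suc k) t ≤? psum b (suc (suc k))
  ... | yes y≤B′ = ≤-trans y≤B′ (m≤m+n _ _)
  ... | no  y≰B′ = Equivalence.to (tableOf-galois P (s≤s z≤n) 1+k<n (B′<y , y≤A′))
                     (≤-trans (Equivalence.from (tableOf-galois P (s≤s z≤n) (<⇒≤ 1+k<n) (B<y , y≤A)) ≤-refl)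
                              (entry-monotone P (s≤s z≤n) 1+k<n (B<y , y≤A) (B′<y , y≤A′)))
    where
    y = tableOf P (suc k) t
    B′<y = ≰⇒> y≰B′
    y≤A = tableOf-upper P (a⊵b (suc k) (<⇒≤ 1+k<n))
    y≤A′ = ≤-trans y≤A (psum-step a (suc k))
    B<y = ≤-<-trans (psum-step b (suc k)) B′<y

  tableOf-isCutTable : a ⊵ b → ∀ P → IsCutTable (tableOf P)
  tableOf-isCutTable a⊵b P = record
    { source-column = λ k≤n → tableOf-source P (a⊵b _ k≤n)
    ; sink-column   = λ {k} _ → tableOf-sink P k
    ; top-row       = tableOf-top P
    ; antitone-step = λ {k} _ _ → +-monoʳ-≤ (psum b k) (count-mono _ _ (psum b k) (psum a k ∸ psum b k) (λ _ _ → ≤-trans (n≤1+n _)))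
    ; monotone-step = λ k<n _ → tableOf-monotone-step P a⊵b k<n
    }

  rowCount : (ℕ → ℕ → ℕ) → ℕ → ℕ → ℕ
  rowCount p k c = count (λ t → c ≤? p k t) 0 m

  module _ {p : ℕ → ℕ → ℕ} (table : IsCutTable p) where
    open IsCutTable table

    rowCount-galois : ∀ {k t c} → k ≤ n → InInterval 0 m t → c ≤ p k t ⇔ t ≤ rowCount p k c
    rowCount-galois {k} {t} {c} k≤n = count-galois (λ t → c ≤? p k t) 0 m closed
      where
      closed : DownClosedOn (λ t → c ≤ p k t) 0 m
      closed _ t≤t' t'≤m c≤p = ≤-trans c≤p (antitone k≤n t≤t' (m≤n⇒m≤1+n t'≤m))

    ppOf : PlanePartition n m a b
    ppOf = record
      { π       = λ r c _ → rowCount p (n ∸ toℕ r) c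
      ; bounded = λ r c _ → count-≤ _ 0 m
      ; rowDec  = λ r c c' _ _ c≤c' → count-mono _ _ 0 m (λ _ _ → ≤-trans c≤c')
      ; colDec  = λ r r' c _ _ r≤r' → count-mono _ _ 0 m (λ t t∈ → flip ≤-trans
                    (monotone (∸-monoʳ-≤ n r≤r') (m∸n≤m n (toℕ r)) (m≤n⇒m≤1+n (proj₂ t∈))))
      }

    entry-ppOf : ∀ {k c} → 1 ≤ k → k ≤ n → InRow k c → entry ppOf k c ≡ rowCount p k c
    entry-ppOf 1≤k k≤n x with row-index 1≤k k≤n
    ... | r , refl = entry-π ppOf {r} x

    tableOf-ppOf : tableOf ppOf ≐ p
    tableOf-ppOf {zero}  {t} _ _ = trans (tableOf-top ppOf t) (sym (top-row t))
    tableOf-ppOf {suc k} {zero} k≤n _ =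
      trans (tableOf-source ppOf (≤-trans (lower-bound k≤n z≤n) (upper-bound k≤n z≤n))) (sym (source-column k≤n))
    tableOf-ppOf {suc k} {suc t} k≤n 1+t≤1+m with m≤n⇒m<n∨m≡n 1+t≤1+m
    ... | inj₂ refl = trans (tableOf-sink ppOf (suc k)) (sym (sink-column k≤n))
    ... | inj₁ (s≤s t<m) = begin
      B + count (λ c → suc t ≤? entry ppOf (suc k) c) B (A ∸ B)  ≡⟨ cong (B +_) (count-cong _ _ B (A ∸ B) same-cells) ⟩
      B + count (λ c → c ≤? p (suc k) (suc t)) B (A ∸ B)         ≡⟨ cong (B +_) (count-threshold B (A ∸ B) _ B≤p p≤A) ⟩
      B + (p (suc k) (suc t) ∸ B)                                ≡⟨ m+[n∸m]≡n B≤p ⟩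
      p (suc k) (suc t)                                          ∎
      where
      open ≡-Reasoning
      B = psum b (suc k) ; A = psum a (suc k)
      B≤p = lower-bound k≤n 1+t≤1+m
      p≤A = subst (p (suc k) (suc t) ≤_) (sym (m+[n∸m]≡n (≤-trans B≤p (upper-bound k≤n 1+t≤1+m)))) (upper-bound k≤n 1+t≤1+m)
      same-cells : ∀ c → InInterval B (A ∸ B) c → suc t ≤ entry ppOf (suc k) c ⇔ c ≤ p (suc k) (suc t)
      same-cells c c∈ = mk⇔ (λ t<e → Equivalence.from (rowCount-galois k≤n (s≤s z≤n , t<m)) (subst (suc t ≤_) e t<e))
                            (λ c≤p → subst (suc t ≤_) (sym e) (Equivalence.to (rowCount-galois k≤n (s≤s z≤n , t<m)) c≤p))
        where e = entry-ppOf (s≤s z≤n) k≤n (Equivalence.from InRow⇔InInterval c∈)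

  ppOf-tableOf : ∀ (a⊵b : a ⊵ b) P r c (x : InCell a b r c) → π (ppOf (tableOf-isCutTable a⊵b P)) r c x ≡ π P r c x
  ppOf-tableOf a⊵b P r c x = begin
    count (λ t → c ≤? tableOf P k t) 0 m  ≡⟨ count-cong _ _ 0 m (λ t _ → ⇔-sym (tableOf-galois P 1≤k k≤n x)) ⟩
    count (λ t → t ≤? entry P k c) 0 m    ≡⟨ count-threshold 0 m (entry P k c) z≤n (entry-≤ P k c) ⟩
    entry P k c                           ≡⟨ entry-π P x ⟩
    π P r c x                             ∎
    where
    open ≡-Reasoning
    k = n ∸ toℕ r
    1≤k = m<n⇒0<n∸m (toℕ<n r)
    k≤n = m∸n≤m n (toℕ r)

  tableOf-cong : ∀ {P Q} → (∀ r c x → π P r c x ≡ π Q r c x) → ∀ k t → tableOf P k t ≡ tableOf Q k t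
  tableOf-cong P≈Q k t = cong (psum b k +_) (count-cong _ _ (psum b k) (psum a k ∸ psum b k) (λ c _ → ≤-congʳ⇔ (entry-cong P≈Q k c)))

  ppOf-cong : ∀ {p q} (tp : IsCutTable p) (tq : IsCutTable q) → p ≐ q → ∀ r c x → π (ppOf tp) r c x ≡ π (ppOf tq) r c x
  ppOf-cong tp tq p≐q r c x = count-cong _ _ 0 m (λ t t∈ → ≤-congʳ⇔ (p≐q (m∸n≤m n (toℕ r)) (m≤n⇒m≤1+n (proj₂ t∈))))

module _ (n m : ℕ) (1≤n : 1 ≤ n) (a b : Fin n → ℕ) (a⊵b : a ⊵ b) where
  open Grid n m
  open Cuts n m a b
  open Diagrams n m a b
  open Setoid (PPSetoid n m a b) using () renaming (_≈_ to _≈ᴾ_)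
  open Setoid (FlowSetoid n m a b) using () renaming (_≈_ to _≈ᶠ_)

  toFlow : PlanePartition n m a b → IntegralFlow n m a b
  toFlow P = flowOf-flow (tableOf-isCutTable a⊵b P) 1≤n

  fromFlow : IntegralFlow n m a b → PlanePartition n m a b
  fromFlow F = ppOf (cut-isCutTable F)

  toFlow-cong : ∀ {P Q} → P ≈ᴾ Q → toFlow P ≈ᶠ toFlow Q
  toFlow-cong P≈Q = flowOf-cong (λ {k} {t} _ _ → tableOf-cong P≈Q k t)

  fromFlow-cong : ∀ {F G} → F ≈ᶠ G → fromFlow F ≈ᴾ fromFlow G
  fromFlow-cong {F} {G} F≈G = ppOf-cong (cut-isCutTable F) (cut-isCutTable G) (λ {k} {t} _ _ → cut-cong F≈G k t)

  toFlow∘fromFlow : ∀ F → toFlow (fromFlow F) ≈ᶠ F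
  toFlow∘fromFlow F u v = trans (flowOf-cong (tableOf-ppOf (cut-isCutTable F)) u v) (flowOf-cut F u v)

  fromFlow∘toFlow : ∀ P → fromFlow (toFlow P) ≈ᴾ P
  fromFlow∘toFlow P r c x = trans (ppOf-cong (cut-isCutTable (toFlow P)) table (cut-flowOf table) r c x) (ppOf-tableOf a⊵b P r c x)
    where table = tableOf-isCutTable a⊵b P

  planePartition↔flow : Inverse (PPSetoid n m a b) (FlowSetoid n m a b)
  planePartition↔flow = record
    { to        = toFlow
    ; from      = fromFlow
    ; to-cong   = λ {P} {Q} → toFlow-cong {P} {Q}
    ; from-cong = λ {F} {G} → fromFlow-cong {F} {G}
    ; inverse   = (λ {F} {P} P≈ → ≈ᶠ-trans {toFlow P} {toFlow (fromFlow F)} {F} (toFlow-cong {P} {fromFlow F} P≈) (toFlow∘fromFlow F))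
                , (λ {P} {F} F≈ → ≈ᴾ-trans {fromFlow F} {fromFlow (toFlow P)} {P} (fromFlow-cong {F} {toFlow P} F≈) (fromFlow∘toFlow P))
    }
    where
    open Setoid (PPSetoid n m a b) using () renaming (trans to ≈ᴾ-trans)
    open Setoid (FlowSetoid n m a b) using () renaming (trans to ≈ᶠ-trans)

theorem3p7 : (n m : ℕ) → 1 ≤ n → 1 ≤ m → (a b : Fin n → ℕ) → a ⊵ b →
             Bijection (PPSetoid n m a b) (FlowSetoid n m a b)
theorem3p7 n m 1≤n _ a b a⊵b = Inverse⇒Bijection (planePartition↔flow n m 1≤n a b a⊵b)
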